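{- Let $G=(V,E)$ be a graph of minimum degree at least $2$ having a vertex of degree at least $3$, let $R\subseteq V$, let $\ell\ge 0$ and $\epsilon\in(0,1)$. Define $\omega(v)=\deg(v)-2$ if $v\notin R$ and $\omega(v)=0$ if $v\in R$, and sample a vertex $v\in V$ with probability $\omega(v)/\omega(V)$. If there exists a riafd-set $F$ of $G$ of size $k$ with $\deg(F)\ge \frac{4-2\epsilon}{1-\epsilon}(k+\ell)$, then the sampled vertex belongs to $F$ with probability at least $\frac{1}{3-\epsilon}$.
   Context: For $X\subseteq V$, $\deg(X)=\sum_{v\in X}\deg(v)$ and $\omega(X)=\sum_{v\in X}\omega(v)$. A graph is an $\ell$-forest if deleting at most $\ell$ of its edges yields a forest. A riafd-set of $G$ (for $R$ and $\ell$) is a set $F\subseteq V$ with $F\cap R=\varnothing$, $F$ independent in $G$, and $G-F$ an $\ell$-forest.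
   Formalization: The parameter $\epsilon$ takes rational values in $(0,1)$ rather than real ones. -}

module Defs where

open import Data.Nat as ℕ using (ℕ; zero; suc; _∸_)
open import Data.Fin as Fin using (Fin; inject₁; fromℕ)
open import Data.Fin.Subset using (Subset)
open import Data.Vec using () renaming (lookup to _at_)
open import Data.List using (List; length; map; allFin; lookup)
open import Data.Nat.ListAction using (sum)
open import Data.List.Relation.Binary.Sublist.Propositional using (_⊆_)
open import Data.Bool using (Bool; true; false; if_then_else_)
open import Data.Product using (Σ; ∃; _×_; _,_; proj₁; proj₂)
open import Data.Sum using (_⊎_)
open import Data.Unit using (tt)
open import Function.Definitions using (Injective)
open import Relation.Binary.PropositionalEquality using (_≡_; subst; sym)
open import Relation.Nullary using (¬_; does)
open import Relation.Nullary.Decidable using (toWitness)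
open import Data.Rational as ℚ using (ℚ; 0ℚ; 1ℚ; _-_; _<_; NonZero)
import Data.Rational.Properties as ℚP

-- Finite multigraphs (loops and parallel edges allowed) on vertex set
-- Fin n, given by a list of edges (each edge an unordered pair stored
-- as an ordered pair of endpoints).

Edge : ℕ → Set
Edge n = Fin n × Fin n

EdgeList : ℕ → Set
EdgeList n = List (Edge n)

[_≟_] : ∀ {n} → Fin n → Fin n → ℕ
[ u ≟ v ] = if does (u Fin.≟ v) then 1 else 0

-- degree: number of edge-endpoint incidences (a loop counts twice)
deg : ∀ {n} → EdgeList n → Fin n → ℕ
deg E v = sum (map (λ e → [ proj₁ e ≟ v ] ℕ.+ [ proj₂ e ≟ v ]) E)

sumOver : ∀ {n} → (Fin n → ℕ) → Subset n → ℕ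
sumOver {n} f X = sum (map (λ v → if (X at v) then f v else 0) (allFin n))

degSet : ∀ {n} → EdgeList n → Subset n → ℕ
degSet E X = sumOver (deg E) X

V : ∀ {n} → Subset n
V = Data.Fin.Subset.⊤
  where import Data.Fin.Subset

ω : ∀ {n} → EdgeList n → Subset n → Fin n → ℕ
ω E R v = if (R at v) then 0 else deg E v ∸ 2

ωSet : ∀ {n} → EdgeList n → Subset n → Subset n → ℕ
ωSet E R X = sumOver (ω E R) X

Joins : ∀ {n} → Edge n → Fin n → Fin n → Set
Joins (a , b) x y = (a ≡ x × b ≡ y) ⊎ (a ≡ y × b ≡ x)

-- A cycle of length k+1: distinct vertices vs 0 , … , vs k (with
-- vs (k+1) = vs 0) and distinct edges es 0 , … , es k (as positions in
-- the edge list), edge es i joining vs i and vs (i+1).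
-- (k = 0: a loop; k = 1: a pair of parallel edges.)
record Cycle {n} (E : EdgeList n) : Set where
  field
    k      : ℕ
    vs     : Fin (suc (suc k)) → Fin n
    closed : vs (fromℕ (suc k)) ≡ vs Fin.zero
    vs-inj : Injective _≡_ _≡_ (λ i → vs (inject₁ i))
    es     : Fin (suc k) → Fin (length E)
    es-inj : Injective _≡_ _≡_ es
    joins  : ∀ i → Joins (lookup E (es i)) (vs (inject₁ i)) (vs (Fin.suc i))

Forest : ∀ {n} → EdgeList n → Set
Forest E = ¬ Cycle E

IsℓForest : ∀ {n} → ℕ → EdgeList n → Set
IsℓForest ℓ E = ∃ λ E′ → E′ ⊆ E × length E ℕ.≤ length E′ ℕ.+ ℓ × Forest E′

deleteVertices : ∀ {n} → Subset n → EdgeList n → EdgeList n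
deleteVertices F = Data.List.filter (λ e → Data.Bool._≟_ ((F at proj₁ e) Data.Bool.∨ (F at proj₂ e)) false)
  where import Data.List ; import Data.Bool

Independent : ∀ {n} → EdgeList n → Subset n → Set
Independent E F = ∀ i → ¬ ((F at proj₁ (lookup E i)) ≡ true × (F at proj₂ (lookup E i)) ≡ true)

Disjoint : ∀ {n} → Subset n → Subset n → Set
Disjoint F R = ∀ v → ¬ ((F at v) ≡ true × (R at v) ≡ true)

record Riafd {n} (E : EdgeList n) (R : Subset n) (ℓ : ℕ) (F : Subset n) : Set where
  field
    disjoint    : Disjoint F R
    independent : Independent E F
    forest      : IsℓForest ℓ (deleteVertices F E)

q-p-nonZero : ∀ {p q : ℚ} → p < q → NonZero (q - p)
q-p-nonZero {p} {q} p<q = ℚP.pos⇒nonZero (q - p) {{ℚ.positive 0<q-p}}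
  where
  0<q-p : 0ℚ < q - p
  0<q-p = subst (_< q - p) (ℚP.+-inverseʳ p) (ℚP.+-monoˡ-< (ℚ.- p) p<q)

3ℚ : ℚ
3ℚ = ℚ._/_ (Data.Integer.+ 3) 1
  where import Data.Integer

1<3 : 1ℚ < 3ℚ
1<3 = toWitness {a? = 1ℚ ℚP.<? 3ℚ} tt

threshold : (ε : ℚ) → ε < 1ℚ → ℚ
threshold ε h = ℚ._÷_ (ℚ._/_ (Data.Integer.+ 4) 1 - ℚ._/_ (Data.Integer.+ 2) 1 ℚ.* ε) (1ℚ - ε) {{q-p-nonZero h}}
  where import Data.Integer

lowerProb : (ε : ℚ) → ε < 1ℚ → ℚ
lowerProb ε h = ℚ.1/_ (3ℚ - ε) {{q-p-nonZero (ℚP.<-trans h 1<3)}}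

-- Probability that a vertex sampled with probability ω(v)/ω(V) lies in F
-- (requires ω(V) > 0 so that the distribution is defined)
sampleProb : ∀ {n} (E : EdgeList n) (R F : Subset n) → 0 ℕ.< ωSet E R V → ℚ
sampleProb E R F pos = ℚ._/_ (Data.Integer.+ ωSet E R F) (ωSet E R V) {{ℕ.>-nonZero pos}}
  where import Data.Integer

-- Write a = ω(F), b = ω(V), k = |F| and c = |V ∖ F|.  As F misses R and every
-- degree is at least 2, deg(F) = a + 2k.  The edges of G - F lie inside V ∖ F,
-- and a forest has at most as many edges as vertices, so G - F has at most
-- c + ℓ edges; since F is independent, every other edge has exactly one end in
-- F, whence deg(V ∖ F) ≤ 2(c + ℓ) + deg(F).  With ω(v) ≤ deg(v) - 2 this gives
-- b ≤ 2a + 2(k + ℓ), while the hypothesis on deg(F) says 2(k + ℓ) ≤ (1 - ε)a;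
-- hence b ≤ (3 - ε)a.  Finally k + ℓ > 0, as otherwise G itself would be a
-- forest although its degrees sum to more than 2|V|; so a > 0, and b ≥ a.

module Submission where

open import Defs
open import Data.Nat using (ℕ; zero; suc; _+_; _≤_; _<_; _∸_; z≤n; s≤s)
import Data.Nat as ℕ
import Data.Nat.Properties as ℕP
open import Algebra.Properties.CommutativeMonoid.Sum ℕP.+-0-commutativeMonoid
  using (∑-distrib-+; sum-cong-≗; sum-replicate-zero) renaming (sum to ∑)
open import Data.Nat.ListAction using (sum)
open import Data.Fin as Fin using (Fin; inject₁; fromℕ)
import Data.Fin.Properties as FinP
open import Data.Fin.Subset using (Subset; ∣_∣)
open import Data.Vec as Vec using () renaming (lookup to _at_)
import Data.Vec.Properties as VecP
open import Data.List using ([]; _∷_; length; lookup; map; tabulate)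
open import Data.List.Relation.Unary.All as All using (All; []; _∷_)
open import Data.List.Membership.Propositional.Properties using (∈-lookup)
open import Data.List.Relation.Binary.Sublist.Propositional.Properties using (All-resp-⊆)
open import Data.List.Relation.Binary.Sublist.Propositional using (_⊆_; []; _∷_; _∷ʳ_)
open import Data.Bool using (Bool; true; false; if_then_else_; _∧_; _∨_; not)
import Data.Bool.Properties as BoolP
open import Data.Product using (Σ; ∃; _×_; _,_; proj₁; proj₂)
open import Data.Sum using (_⊎_; inj₁; inj₂)
open import Data.Empty using (⊥-elim)
open import Function using (_∘_)
open import Function.Definitions using (Injective)
open import Relation.Binary.PropositionalEquality
  using (_≡_; _≢_; refl; sym; trans; cong; cong₂; subst; subst₂; module ≡-Reasoning)
open import Relation.Nullary using (¬_; Dec; yes; no; does)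
open import Relation.Nullary.Decidable using (_⊎-dec_)
open import Data.Nat.Tactic.RingSolver using (solve-∀)
import Data.Nat.Coprimality as Coprime
open import Data.Integer using (+_)
import Data.Integer as ℤ
import Data.Integer.Properties as ℤP
open import Data.Rational as ℚ using (ℚ; mkℚ; 0ℚ; 1ℚ)
import Data.Rational.Properties as ℚP
import Data.Rational.Unnormalised as ℚᵘ
open import Data.Rational.Solver using (module +-*-Solver)
open +-*-Solver using (solve; _:+_; _:*_; _:-_; con; _:=_)
import Data.Rational.Unnormalised.Properties as ℚᵘP

𝟙 : Bool → ℕ
𝟙 b = if b then 1 else 0

restrict : ∀ {n} → (Fin n → Bool) → (Fin n → ℕ) → Fin n → ℕ
restrict X f v = if X v then f v else 0

size : ∀ {n} → (Fin n → Bool) → ℕ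
size X = ∑ (𝟙 ∘ X)

∑-mono-≤ : ∀ {n} {f g : Fin n → ℕ} → (∀ v → f v ≤ g v) → ∑ f ≤ ∑ g
∑-mono-≤ {zero}  f≤g = z≤n
∑-mono-≤ {suc n} f≤g = ℕP.+-mono-≤ (f≤g Fin.zero) (∑-mono-≤ (f≤g ∘ Fin.suc))

∑-mono-< : ∀ {n} {f g : Fin n → ℕ} → (∀ v → f v ≤ g v) → ∀ w → f w < g w → ∑ f < ∑ g
∑-mono-< f≤g Fin.zero    fw<gw = ℕP.+-mono-<-≤ fw<gw (∑-mono-≤ (f≤g ∘ Fin.suc))
∑-mono-< f≤g (Fin.suc w) fw<gw = ℕP.+-mono-≤-< (f≤g Fin.zero) (∑-mono-< (f≤g ∘ Fin.suc) w fw<gw)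

∑-zero : ∀ {n} {f : Fin n → ℕ} → (∀ v → f v ≡ 0) → ∑ f ≡ 0
∑-zero {n} f≡0 = trans (sum-cong-≗ f≡0) (sum-replicate-zero n)

∑≡0-transfer : ∀ {n} {f g : Fin n → ℕ} → (∀ v → f v ≡ 0 → g v ≡ 0) → ∑ f ≡ 0 → ∑ g ≡ 0
∑≡0-transfer {zero}  g≡0 ∑f≡0 = refl
∑≡0-transfer {suc n} {f} g≡0 ∑f≡0 = cong₂ _+_
  (g≡0 Fin.zero (ℕP.m+n≡0⇒m≡0 _ ∑f≡0))
  (∑≡0-transfer (g≡0 ∘ Fin.suc) (ℕP.m+n≡0⇒n≡0 (f Fin.zero) ∑f≡0))

∑-drop-point : ∀ {n} {f g : Fin n → ℕ} → (∀ u → g u ≤ f u) → ∀ v → g v ≡ 0 → ∑ g + f v ≤ ∑ f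
∑-drop-point {f = f} g≤f Fin.zero gv≡0 rewrite gv≡0 =
  ℕP.≤-trans (ℕP.≤-reflexive (ℕP.+-comm _ (f Fin.zero)))
             (ℕP.+-monoʳ-≤ (f Fin.zero) (∑-mono-≤ (g≤f ∘ Fin.suc)))
∑-drop-point {g = g} g≤f (Fin.suc v) gv≡0 =
  ℕP.≤-trans (ℕP.≤-reflexive (ℕP.+-assoc (g Fin.zero) _ _))
    (ℕP.+-mono-≤ (g≤f Fin.zero) (∑-drop-point (g≤f ∘ Fin.suc) v gv≡0))

sum-map-tabulate : ∀ {n} {A : Set} (g : A → ℕ) (h : Fin n → A) → sum (map g (tabulate h)) ≡ ∑ (g ∘ h)
sum-map-tabulate {zero}  g h = refl
sum-map-tabulate {suc n} g h = cong (_+_ (g (h Fin.zero))) (sum-map-tabulate g (h ∘ Fin.suc))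

sumOver≡∑ : ∀ {n} (f : Fin n → ℕ) (X : Subset n) → sumOver f X ≡ ∑ (restrict (X at_) f)
sumOver≡∑ f X = sum-map-tabulate (restrict (X at_) f) (λ v → v)

∣∣≡size : ∀ {n} (X : Subset n) → ∣ X ∣ ≡ size (X at_)
∣∣≡size Vec.[]           = refl
∣∣≡size (true  Vec.∷ X) = cong suc (∣∣≡size X)
∣∣≡size (false Vec.∷ X) = ∣∣≡size X

restrict-const-0 : ∀ {n} (X : Fin n → Bool) v → restrict X (λ _ → 0) v ≡ 0
restrict-const-0 X v with X v
... | true  = refl
... | false = refl

restrict-+ : ∀ {n} (X : Fin n → Bool) (f g : Fin n → ℕ) v →
             restrict X (λ u → f u + g u) v ≡ restrict X f v + restrict X g v
restrict-+ X f g v with X v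
... | true  = refl
... | false = refl

restrict≤ : ∀ {n} (X : Fin n → Bool) (f : Fin n → ℕ) v → restrict X f v ≤ f v
restrict≤ X f v with X v
... | true  = ℕP.≤-refl
... | false = z≤n

restrict-split : ∀ {n} (X : Fin n → Bool) (f : Fin n → ℕ) v → f v ≡ restrict X f v + restrict (not ∘ X) f v
restrict-split X f v with X v
... | true  = sym (ℕP.+-identityʳ (f v))
... | false = refl

∑-restrict-+ : ∀ {n} (X : Fin n → Bool) (f g : Fin n → ℕ) →
               ∑ (restrict X (λ u → f u + g u)) ≡ ∑ (restrict X f) + ∑ (restrict X g)
∑-restrict-+ X f g = trans (sum-cong-≗ (restrict-+ X f g)) (∑-distrib-+ (restrict X f) (restrict X g))

∑-restrict-≟ : ∀ {n} (X : Fin n → Bool) (a : Fin n) → ∑ (restrict X (λ v → [ a ≟ v ])) ≡ 𝟙 (X a)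
∑-restrict-≟ {suc n} X Fin.zero =
  trans (cong (_+_ (𝟙 (X Fin.zero))) (∑-zero (restrict-const-0 (X ∘ Fin.suc)))) (ℕP.+-identityʳ _)
∑-restrict-≟ {suc n} X (Fin.suc a) =
  cong₂ _+_ (restrict-const-0 X Fin.zero) (∑-restrict-≟ (X ∘ Fin.suc) a)

endsIn : ∀ {n} → (Fin n → Bool) → Edge n → ℕ
endsIn X e = 𝟙 (X (proj₁ e)) + 𝟙 (X (proj₂ e))

handshake : ∀ {n} (X : Fin n → Bool) (E : EdgeList n) → ∑ (restrict X (deg E)) ≡ sum (map (endsIn X) E)
handshake X [] = ∑-zero (restrict-const-0 X)
handshake X ((a , b) ∷ E) = begin
  ∑ (restrict X (λ v → ([ a ≟ v ] + [ b ≟ v ]) + deg E v))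
    ≡⟨ ∑-restrict-+ X _ (deg E) ⟩
  ∑ (restrict X (λ v → [ a ≟ v ] + [ b ≟ v ])) + ∑ (restrict X (deg E))
    ≡⟨ cong₂ _+_ (∑-restrict-+ X (λ v → [ a ≟ v ]) (λ v → [ b ≟ v ])) (handshake X E) ⟩
  (∑ (restrict X (λ v → [ a ≟ v ])) + ∑ (restrict X (λ v → [ b ≟ v ]))) + sum (map (endsIn X) E)
    ≡⟨ cong (_+ sum (map (endsIn X) E)) (cong₂ _+_ (∑-restrict-≟ X a) (∑-restrict-≟ X b)) ⟩
  endsIn X (a , b) + sum (map (endsIn X) E) ∎
  where open ≡-Reasoning

EdgeWithin : ∀ {n} → (Fin n → Bool) → Edge n → Set
EdgeWithin P e = P (proj₁ e) ≡ true × P (proj₂ e) ≡ true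

length-deleteVertices-∷ : ∀ {n} (F : Subset n) (a b : Fin n) (E : EdgeList n) →
  length (deleteVertices F ((a , b) ∷ E)) ≡ 𝟙 (not (F at a ∨ F at b)) + length (deleteVertices F E)
length-deleteVertices-∷ F a b E with F at a | F at b
... | true  | _     = refl
... | false | true  = refl
... | false | false = refl

deleteVertices-avoids : ∀ {n} (F : Subset n) (E : EdgeList n) →
                        All (EdgeWithin (not ∘ (F at_))) (deleteVertices F E)
deleteVertices-avoids F [] = []
deleteVertices-avoids F ((a , b) ∷ E) with F at a in Fa | F at b in Fb
... | true  | _     = deleteVertices-avoids F E
... | false | true  = deleteVertices-avoids F E
... | false | false = (cong not Fa , cong not Fb) ∷ deleteVertices-avoids F E

ends-outside-edge : ∀ x y → ¬ (x ≡ true × y ≡ true) →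
  𝟙 (not x) + 𝟙 (not y) ≤ (𝟙 (not (x ∨ y)) + 𝟙 (not (x ∨ y))) + (𝟙 x + 𝟙 y)
ends-outside-edge true  true  both = ⊥-elim (both (refl , refl))
ends-outside-edge true  false _    = ℕP.≤-refl
ends-outside-edge false true  _    = ℕP.≤-refl
ends-outside-edge false false _    = ℕP.≤-refl

ends-outside-independent : ∀ {n} (F : Subset n) (E : EdgeList n) → Independent E F →
  sum (map (endsIn (not ∘ (F at_))) E) ≤
  (length (deleteVertices F E) + length (deleteVertices F E)) + sum (map (endsIn (F at_)) E)
ends-outside-independent F [] independent = z≤n
ends-outside-independent F ((a , b) ∷ E) independent
  rewrite length-deleteVertices-∷ F a b E =
  ℕP.≤-trans
    (ℕP.+-mono-≤ (ends-outside-edge (F at a) (F at b) (independent Fin.zero))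
                 (ends-outside-independent F E (independent ∘ Fin.suc)))
    (ℕP.≤-reflexive (regroup (𝟙 (not (F at a ∨ F at b))) (length (deleteVertices F E)) _ _))
  where
  regroup : ∀ x y p q → ((x + x) + p) + ((y + y) + q) ≡ ((x + y) + (x + y)) + (p + q)
  regroup = solve-∀

Joins-sym : ∀ {n} {e : Edge n} {x y} → Joins e x y → Joins e y x
Joins-sym (inj₁ p) = inj₂ p
Joins-sym (inj₂ p) = inj₁ p

Joins-unique : ∀ {n} {e : Edge n} {x y x′ y′} → Joins e x y → Joins e x′ y′ →
               (x ≡ x′ × y ≡ y′) ⊎ (x ≡ y′ × y ≡ x′)
Joins-unique (inj₁ (refl , refl)) (inj₁ (refl , refl)) = inj₁ (refl , refl)
Joins-unique (inj₁ (refl , refl)) (inj₂ (refl , refl)) = inj₂ (refl , refl)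
Joins-unique (inj₂ (refl , refl)) (inj₁ (refl , refl)) = inj₂ (refl , refl)
Joins-unique (inj₂ (refl , refl)) (inj₂ (refl , refl)) = inj₁ (refl , refl)

Joins-within : ∀ {n} {P : Fin n → Bool} {e : Edge n} {x y} → EdgeWithin P e → Joins e x y → P x ≡ true
Joins-within (Pa , Pb) (inj₁ (refl , refl)) = Pa
Joins-within (Pa , Pb) (inj₂ (refl , refl)) = Pb

Joins-self : ∀ {n} {e : Edge n} {x} → Joins e x x → proj₁ e ≡ proj₂ e
Joins-self (inj₁ (refl , refl)) = refl
Joins-self (inj₂ (refl , refl)) = refl

Touches : ∀ {n} → Fin n → Edge n → Set
Touches v e = proj₁ e ≡ v ⊎ proj₂ e ≡ v

touches? : ∀ {n} (v : Fin n) (e : Edge n) → Dec (Touches v e)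
touches? v e = (proj₁ e Fin.≟ v) ⊎-dec (proj₂ e Fin.≟ v)

Joins⇒Touches : ∀ {n} {e : Edge n} {x y} → Joins e x y → Touches x e
Joins⇒Touches (inj₁ (refl , _)) = inj₁ refl
Joins⇒Touches (inj₂ (_ , refl)) = inj₂ refl

incidence : ∀ {n} → Edge n → Fin n → ℕ
incidence e v = [ proj₁ e ≟ v ] + [ proj₂ e ≟ v ]

incidence-Joins : ∀ {n} (e : Edge n) u → 1 ≤ incidence e u → ∃ λ w → Joins e u w
incidence-Joins (a , b) u 1≤ with a Fin.≟ u | b Fin.≟ u
... | yes refl | _        = b , inj₁ (refl , refl)
... | no _     | yes refl = a , inj₂ (refl , refl)
... | no _     | no _     = ⊥-elim (ℕP.<-irrefl refl 1≤)

incidence≤1 : ∀ {n} (e : Edge n) u → proj₁ e ≢ proj₂ e → incidence e u ≤ 1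
incidence≤1 (a , b) u a≢b with a Fin.≟ u | b Fin.≟ u
... | yes refl | yes refl = ⊥-elim (a≢b refl)
... | yes _    | no _     = ℕP.≤-refl
... | no _     | yes _    = ℕP.≤-refl
... | no _     | no _     = z≤n

Touches⇒incidence : ∀ {n} (e : Edge n) u → Touches u e → 1 ≤ incidence e u
Touches⇒incidence (a , b) u touches with a Fin.≟ u | b Fin.≟ u
... | yes _  | _      = s≤s z≤n
... | no _   | yes _  = s≤s z≤n
... | no a≢u | no b≢u with touches
...   | inj₁ a≡u = ⊥-elim (a≢u a≡u)
...   | inj₂ b≡u = ⊥-elim (b≢u b≡u)

incidence-lookup≤deg : ∀ {n} (E : EdgeList n) j u → incidence (lookup E j) u ≤ deg E u
incidence-lookup≤deg (e ∷ E) Fin.zero    u = ℕP.m≤m+n _ _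
incidence-lookup≤deg (e ∷ E) (Fin.suc j) u =
  ℕP.≤-trans (incidence-lookup≤deg E j u) (ℕP.m≤n+m _ (incidence e u))

Joins⇒deg : ∀ {n} (E : EdgeList n) j {u w} → Joins (lookup E j) u w → 1 ≤ deg E u
Joins⇒deg E j {u} joins =
  ℕP.≤-trans (Touches⇒incidence (lookup E j) u (Joins⇒Touches joins)) (incidence-lookup≤deg E j u)

Loopless : ∀ {n} → EdgeList n → Set
Loopless E = ∀ i → proj₁ (lookup E i) ≢ proj₂ (lookup E i)

deg-∷-off : ∀ {n} (e : Edge n) (E : EdgeList n) u → ¬ 1 ≤ incidence e u → deg (e ∷ E) u ≡ deg E u
deg-∷-off e E u 1≰inc = cong (_+ deg E u) (ℕP.n<1⇒n≡0 (ℕP.≰⇒> 1≰inc))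

incident-edge : ∀ {n} (E : EdgeList n) u → 1 ≤ deg E u → ∃ λ j → ∃ λ w → Joins (lookup E j) u w
incident-edge (e ∷ E) u 1≤deg with 1 ℕ.≤? incidence e u
... | yes 1≤inc = Fin.zero , incidence-Joins e u 1≤inc
... | no 1≰inc with incident-edge E u (subst (1 ≤_) (deg-∷-off e E u 1≰inc) 1≤deg)
...   | j , w , joins = Fin.suc j , w , joins

another-incident-edge : ∀ {n} (E : EdgeList n) u (i : Fin (length E)) → Loopless E → 2 ≤ deg E u →
                        ∃ λ j → j ≢ i × ∃ λ w → Joins (lookup E j) u w
another-incident-edge (e ∷ E) u Fin.zero loopless 2≤deg
  with incident-edge E u (ℕP.+-cancelˡ-≤ 1 1 (deg E u)
         (ℕP.≤-trans 2≤deg (ℕP.+-monoˡ-≤ (deg E u) (incidence≤1 e u (loopless Fin.zero)))))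
... | j , joins = Fin.suc j , (λ ()) , joins
another-incident-edge (e ∷ E) u (Fin.suc i) loopless 2≤deg with 1 ℕ.≤? incidence e u
... | yes 1≤inc = Fin.zero , (λ ()) , incidence-Joins e u 1≤inc
... | no 1≰inc
  with another-incident-edge E u i (loopless ∘ Fin.suc) (subst (2 ≤_) (deg-∷-off e E u 1≰inc) 2≤deg)
...   | j , j≢i , joins = Fin.suc j , (j≢i ∘ FinP.suc-injective) , joins

loop⇒Cycle : ∀ {n} (E : EdgeList n) i → proj₁ (lookup E i) ≡ proj₂ (lookup E i) → Cycle E
loop⇒Cycle E i loop = record
  { k      = 0
  ; vs     = λ _ → proj₁ (lookup E i)
  ; closed = refl
  ; vs-inj = λ { {Fin.zero} {Fin.zero} _ → refl }
  ; es     = λ _ → i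
  ; es-inj = λ { {Fin.zero} {Fin.zero} _ → refl }
  ; joins  = λ { Fin.zero → inj₁ (refl , sym loop) }
  }

last-or-inject₁ : ∀ {m} (t : Fin (suc m)) → t ≡ fromℕ m ⊎ ∃ λ t′ → t ≡ inject₁ t′
last-or-inject₁ {zero}  Fin.zero    = inj₁ refl
last-or-inject₁ {suc m} Fin.zero    = inj₂ (Fin.zero , refl)
last-or-inject₁ {suc m} (Fin.suc t) with last-or-inject₁ t
... | inj₁ refl         = inj₁ refl
... | inj₂ (t′ , refl) = inj₂ (Fin.suc t′ , refl)

module Paths {n} (E : EdgeList n) (loopless : Loopless E) where

  -- A path is stored backwards: vs zero is the end being extended and es zero
  -- the edge added last.
  record Path (m : ℕ) : Set where
    field
      vs     : Fin (suc (suc m)) → Fin n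
      vs-inj : Injective _≡_ _≡_ vs
      es     : Fin (suc m) → Fin (length E)
      es-inj : Injective _≡_ _≡_ es
      joins  : ∀ i → Joins (lookup E (es i)) (vs (inject₁ i)) (vs (Fin.suc i))

  open Path

  edge⇒Path : Fin (length E) → Path 0
  edge⇒Path i = record
    { vs     = λ { Fin.zero → proj₂ (lookup E i) ; (Fin.suc Fin.zero) → proj₁ (lookup E i) }
    ; vs-inj = λ { {Fin.zero}          {Fin.zero}          _  → refl
                 ; {Fin.zero}          {Fin.suc Fin.zero} eq → ⊥-elim (loopless i (sym eq))
                 ; {Fin.suc Fin.zero} {Fin.zero}          eq → ⊥-elim (loopless i eq)
                 ; {Fin.suc Fin.zero} {Fin.suc Fin.zero} _  → refl }
    ; es     = λ _ → i
    ; es-inj = λ { {Fin.zero} {Fin.zero} _ → refl }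
    ; joins  = λ { Fin.zero → inj₂ (refl , refl) }
    }

  extend : ∀ {m} (p : Path m) {j w} → Joins (lookup E j) (vs p Fin.zero) w → (∀ t → vs p t ≢ w) → Path (suc m)
  extend p {j} {w} jw fresh = record
    { vs     = vs′
    ; vs-inj = vs′-inj
    ; es     = es′
    ; es-inj = es′-inj
    ; joins  = λ { Fin.zero → Joins-sym jw ; (Fin.suc i) → joins p i }
    }
    where
    vs′ : Fin _ → Fin n
    vs′ Fin.zero    = w
    vs′ (Fin.suc t) = vs p t
    vs′-inj : Injective _≡_ _≡_ vs′
    vs′-inj {Fin.zero}  {Fin.zero}  _  = refl
    vs′-inj {Fin.zero}  {Fin.suc y} eq = ⊥-elim (fresh y (sym eq))
    vs′-inj {Fin.suc x} {Fin.zero}  eq = ⊥-elim (fresh x eq)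
    vs′-inj {Fin.suc x} {Fin.suc y} eq = cong Fin.suc (vs-inj p eq)
    es′ : Fin _ → Fin (length E)
    es′ Fin.zero    = j
    es′ (Fin.suc i) = es p i
    new-edge : ∀ i → j ≢ es p i
    new-edge i refl with Joins-unique jw (joins p i)
    ... | inj₁ (_ , w≡) = fresh (Fin.suc i) (sym w≡)
    ... | inj₂ (_ , w≡) = fresh (inject₁ i) (sym w≡)
    es′-inj : Injective _≡_ _≡_ es′
    es′-inj {Fin.zero}  {Fin.zero}  _  = refl
    es′-inj {Fin.zero}  {Fin.suc y} eq = ⊥-elim (new-edge y eq)
    es′-inj {Fin.suc x} {Fin.zero}  eq = ⊥-elim (new-edge x (sym eq))
    es′-inj {Fin.suc x} {Fin.suc y} eq = cong Fin.suc (es-inj p eq)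

  drop-last : ∀ {m} → Path (suc m) → Path m
  drop-last p = record
    { vs     = vs p ∘ inject₁
    ; vs-inj = FinP.inject₁-injective ∘ vs-inj p
    ; es     = es p ∘ inject₁
    ; es-inj = FinP.inject₁-injective ∘ es-inj p
    ; joins  = joins p ∘ inject₁
    }

  close-at-last : ∀ {m} (p : Path m) {j w} → j ≢ es p Fin.zero → Joins (lookup E j) (vs p Fin.zero) w →
                  vs p (fromℕ (suc m)) ≡ w → Cycle E
  close-at-last {m} p {j} {w} j≢ jw last≡w = record
    { k      = suc m
    ; vs     = cvs
    ; closed = last≡w
    ; vs-inj = cvs-inj
    ; es     = ces
    ; es-inj = ces-inj
    ; joins  = λ { Fin.zero → Joins-sym jw ; (Fin.suc i) → joins p i }
    }
    where
    cvs : Fin (suc (suc (suc m))) → Fin n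
    cvs Fin.zero    = w
    cvs (Fin.suc t) = vs p t
    not-last : ∀ t → w ≢ vs p (inject₁ t)
    not-last t w≡ = FinP.fromℕ≢inject₁ (vs-inj p (trans last≡w w≡))
    cvs-inj : Injective _≡_ _≡_ (cvs ∘ inject₁)
    cvs-inj {Fin.zero}  {Fin.zero}  _  = refl
    cvs-inj {Fin.zero}  {Fin.suc y} eq = ⊥-elim (not-last y eq)
    cvs-inj {Fin.suc x} {Fin.zero}  eq = ⊥-elim (not-last x (sym eq))
    cvs-inj {Fin.suc x} {Fin.suc y} eq = cong Fin.suc (FinP.inject₁-injective (vs-inj p eq))
    ces : Fin (suc (suc m)) → Fin (length E)
    ces Fin.zero    = j
    ces (Fin.suc i) = es p i
    new-edge : ∀ i → j ≢ es p i
    new-edge i refl with Joins-unique jw (joins p i)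
    new-edge Fin.zero    refl | inj₁ _ = j≢ refl
    new-edge (Fin.suc i) refl | inj₁ (head≡ , _) with vs-inj p head≡
    ... | ()
    new-edge i refl | inj₂ (head≡ , _) with vs-inj p head≡
    ... | ()
    ces-inj : Injective _≡_ _≡_ ces
    ces-inj {Fin.zero}  {Fin.zero}  _  = refl
    ces-inj {Fin.zero}  {Fin.suc y} eq = ⊥-elim (new-edge y eq)
    ces-inj {Fin.suc x} {Fin.zero}  eq = ⊥-elim (new-edge x (sym eq))
    ces-inj {Fin.suc x} {Fin.suc y} eq = cong Fin.suc (es-inj p eq)

  -- Dropping the oldest vertices until the earlier visit of w is the oldest one.
  close : ∀ {m} (p : Path m) {j w} → j ≢ es p Fin.zero → Joins (lookup E j) (vs p Fin.zero) w →
          ∀ t → vs p t ≡ w → Cycle E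
  close {zero} p {j} j≢ jw t vt≡w with last-or-inject₁ t
  ... | inj₁ refl              = close-at-last p j≢ jw vt≡w
  ... | inj₂ (Fin.zero , refl) = ⊥-elim (loopless j (Joins-self (subst (Joins _ _) (sym vt≡w) jw)))
  close {suc m} p j≢ jw t vt≡w with last-or-inject₁ t
  ... | inj₁ refl         = close-at-last p j≢ jw vt≡w
  ... | inj₂ (t′ , refl) = close (drop-last p) j≢ jw t′ vt≡w

  module _ (degree≥2 : ∀ v → 1 ≤ deg E v → 2 ≤ deg E v) where

    walk : ∀ {m} (fuel : ℕ) → Path m → n ≤ suc m + fuel → Cycle E
    walk {m} zero p n≤ = ⊥-elim (ℕP.<-irrefl refl
      (ℕP.≤-trans (FinP.injective⇒≤ (vs-inj p)) (ℕP.≤-trans n≤ (ℕP.≤-reflexive (ℕP.+-identityʳ _)))))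
    walk {m} (suc fuel) p n≤
      with another-incident-edge E (vs p Fin.zero) (es p Fin.zero) loopless
             (degree≥2 _ (Joins⇒deg E (es p Fin.zero) (joins p Fin.zero)))
    ... | j , j≢ , w , jw with FinP.any? (λ t → vs p t Fin.≟ w)
    ...   | yes (t , vt≡w) = close p j≢ jw t vt≡w
    ...   | no fresh       = walk fuel (extend p jw (λ t vt≡w → fresh (t , vt≡w)))
                                  (ℕP.≤-trans n≤ (ℕP.≤-reflexive (ℕP.+-suc (suc m) fuel)))

    min-degree-2⇒Cycle : Fin (length E) → Cycle E
    min-degree-2⇒Cycle i = walk n (edge⇒Path i) (ℕP.n≤1+n n)

⊆-index : ∀ {n} {E₁ E₂ : EdgeList n} → E₁ ⊆ E₂ → Fin (length E₁) → Fin (length E₂)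
⊆-index (_ ∷ʳ sub)   i           = Fin.suc (⊆-index sub i)
⊆-index (refl ∷ sub) Fin.zero    = Fin.zero
⊆-index (refl ∷ sub) (Fin.suc i) = Fin.suc (⊆-index sub i)

⊆-index-injective : ∀ {n} {E₁ E₂ : EdgeList n} (sub : E₁ ⊆ E₂) → Injective _≡_ _≡_ (⊆-index sub)
⊆-index-injective (_ ∷ʳ sub)   eq = ⊆-index-injective sub (FinP.suc-injective eq)
⊆-index-injective (refl ∷ sub) {Fin.zero}  {Fin.zero}  _  = refl
⊆-index-injective (refl ∷ sub) {Fin.suc i} {Fin.suc j} eq =
  cong Fin.suc (⊆-index-injective sub (FinP.suc-injective eq))

lookup-⊆-index : ∀ {n} {E₁ E₂ : EdgeList n} (sub : E₁ ⊆ E₂) i → lookup E₂ (⊆-index sub i) ≡ lookup E₁ i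
lookup-⊆-index (_ ∷ʳ sub)   i           = lookup-⊆-index sub i
lookup-⊆-index (refl ∷ sub) Fin.zero    = refl
lookup-⊆-index (refl ∷ sub) (Fin.suc i) = lookup-⊆-index sub i

Cycle-⊆ : ∀ {n} {E₁ E₂ : EdgeList n} → E₁ ⊆ E₂ → Cycle E₁ → Cycle E₂
Cycle-⊆ sub c = record
  { k      = k
  ; vs     = vs
  ; closed = closed
  ; vs-inj = vs-inj
  ; es     = ⊆-index sub ∘ es
  ; es-inj = es-inj ∘ ⊆-index-injective sub
  ; joins  = λ i → subst (λ e → Joins e (vs (inject₁ i)) (vs (Fin.suc i)))
                        (sym (lookup-⊆-index sub (es i))) (joins i)
  }
  where open Cycle c

removeVertex : ∀ {n} → Fin n → EdgeList n → EdgeList n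
removeVertex v [] = []
removeVertex v (e ∷ E) with touches? v e
... | yes _ = removeVertex v E
... | no _  = e ∷ removeVertex v E

removeVertex-⊆ : ∀ {n} v (E : EdgeList n) → removeVertex v E ⊆ E
removeVertex-⊆ v [] = []
removeVertex-⊆ v (e ∷ E) with touches? v e
... | yes _ = e ∷ʳ removeVertex-⊆ v E
... | no _  = refl ∷ removeVertex-⊆ v E

length-removeVertex : ∀ {n} v (E : EdgeList n) → length E ≤ length (removeVertex v E) + deg E v
length-removeVertex v [] = z≤n
length-removeVertex v (e ∷ E) with touches? v e
... | yes touches = begin
  suc (length E)                                       ≤⟨ s≤s (length-removeVertex v E) ⟩
  suc (length (removeVertex v E) + deg E v)            ≡⟨ ℕP.+-suc _ (deg E v) ⟨
  length (removeVertex v E) + suc (deg E v)            ≤⟨ ℕP.+-monoʳ-≤ (length (removeVertex v E))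
                                                           (ℕP.+-monoˡ-≤ (deg E v) (Touches⇒incidence e v touches)) ⟩
  length (removeVertex v E) + (incidence e v + deg E v) ∎
  where open ℕP.≤-Reasoning
... | no _ = s≤s (ℕP.≤-trans (length-removeVertex v E)
                   (ℕP.+-monoʳ-≤ (length (removeVertex v E)) (ℕP.m≤n+m (deg E v) (incidence e v))))

_∖_ : ∀ {n} → (Fin n → Bool) → Fin n → Fin n → Bool
(P ∖ v) u = P u ∧ not (does (u Fin.≟ v))

removeVertex-within : ∀ {n} (P : Fin n → Bool) v (E : EdgeList n) →
                      All (EdgeWithin P) E → All (EdgeWithin (P ∖ v)) (removeVertex v E)
removeVertex-within P v [] [] = []
removeVertex-within P v (e ∷ E) (e-within ∷ within) with touches? v e
... | yes _        = removeVertex-within P v E within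
... | no untouched = (keep (proj₁ e-within) (untouched ∘ inj₁) , keep (proj₂ e-within) (untouched ∘ inj₂))
                     ∷ removeVertex-within P v E within
  where
  keep : ∀ {u} → P u ≡ true → u ≢ v → (P ∖ v) u ≡ true
  keep {u} Pu u≢v with u Fin.≟ v
  ... | yes u≡v = ⊥-elim (u≢v u≡v)
  ... | no _    rewrite Pu = refl

size-∖ : ∀ {n} (P : Fin n → Bool) v → P v ≡ true → suc (size (P ∖ v)) ≤ size P
size-∖ P v Pv = subst (_≤ size P) (trans (cong (_+_ (size (P ∖ v))) (cong 𝟙 Pv)) (ℕP.+-comm _ 1))
  (∑-drop-point (λ u → 𝟙-∧ (P u) _) v (removed v))
  where
  𝟙-∧ : ∀ a b → 𝟙 (a ∧ b) ≤ 𝟙 a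
  𝟙-∧ true  true  = ℕP.≤-refl
  𝟙-∧ true  false = z≤n
  𝟙-∧ false _     = z≤n
  removed : ∀ v → 𝟙 ((P ∖ v) v) ≡ 0
  removed v with v Fin.≟ v
  ... | yes _ = cong 𝟙 (BoolP.∧-zeroʳ (P v))
  ... | no v≢v = ⊥-elim (v≢v refl)

deg⇒within : ∀ {n} {P : Fin n → Bool} (E : EdgeList n) → All (EdgeWithin P) E → ∀ v → 1 ≤ deg E v → P v ≡ true
deg⇒within E within v 1≤deg with incident-edge E v 1≤deg
... | j , _ , jw = Joins-within (All.lookup within (∈-lookup j)) jw

-- Either some edge is a loop, or deleting a vertex of degree 1 loses one
-- vertex and one edge, or every non-isolated vertex has degree at least 2 and a
-- walk never leaving along the edge it came in by closes a cycle.
edges>size⇒Cycle : ∀ {n} (fuel : ℕ) (E : EdgeList n) (P : Fin n → Bool) → size P ≤ fuel →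
                 All (EdgeWithin P) E → size P < length E → Cycle E
edges>size⇒Cycle fuel E P P≤fuel within P<E
  with FinP.any? (λ i → proj₁ (lookup E i) Fin.≟ proj₂ (lookup E i))
... | yes (i , loop) = loop⇒Cycle E i loop
... | no loopfree with FinP.any? (λ v → deg E v ℕ.≟ 1)
...   | no no-leaf = Paths.min-degree-2⇒Cycle E (λ i loop → loopfree (i , loop))
                       (λ v 1≤deg → ℕP.≤∧≢⇒< 1≤deg (λ 1≡deg → no-leaf (v , sym 1≡deg))) (Fin.fromℕ< P<E)
...   | yes (v , deg≡1) with size-∖ P v (deg⇒within E within v (ℕP.≤-reflexive (sym deg≡1))) | fuel
...     | P∖v<P | zero       = ⊥-elim (ℕP.n≮0 (ℕP.≤-trans P∖v<P P≤fuel))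
...     | P∖v<P | suc fuel′ =
  Cycle-⊆ (removeVertex-⊆ v E)
    (edges>size⇒Cycle fuel′ (removeVertex v E) (P ∖ v) (ℕP.≤-pred (ℕP.≤-trans P∖v<P P≤fuel))
      (removeVertex-within P v E within) (ℕP.+-cancelʳ-< 1 _ _ P∖v<E∖v))
  where
  P∖v<E∖v : size (P ∖ v) + 1 < length (removeVertex v E) + 1
  P∖v<E∖v = begin-strict
    size (P ∖ v) + 1                ≡⟨ ℕP.+-comm _ 1 ⟩
    suc (size (P ∖ v))              ≤⟨ P∖v<P ⟩
    size P                          <⟨ P<E ⟩
    length E                        ≤⟨ length-removeVertex v E ⟩
    length (removeVertex v E) + deg E v ≡⟨ cong (_+_ (length (removeVertex v E))) deg≡1 ⟩
    length (removeVertex v E) + 1   ∎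
    where open ℕP.≤-Reasoning

forest-edges≤ : ∀ {n} (E : EdgeList n) (P : Fin n → Bool) → All (EdgeWithin P) E → Forest E → length E ≤ size P
forest-edges≤ E P within forest = ℕP.≮⇒≥ (forest ∘ edges>size⇒Cycle (size P) E P ℕP.≤-refl within)

module Counting {n} (E : EdgeList n) (deg≥2 : ∀ v → 2 ≤ deg E v)
                (R : Subset n) (ℓ : ℕ) (F : Subset n) (riafd : Riafd E R ℓ F) where

  open Riafd riafd

  inF outF : Fin n → Bool
  inF  = F at_
  outF = not ∘ inF

  k c H : ℕ
  k = ∣ F ∣
  c = size outF
  H = length (deleteVertices F E)

  ω≤deg∸2 : ∀ v → ω E R v ≤ deg E v ∸ 2
  ω≤deg∸2 v with R at v
  ... | true  = z≤n
  ... | false = ℕP.≤-refl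

  ω+2≡deg-on-F : ∀ v → restrict inF (ω E R) v + (𝟙 (inF v) + 𝟙 (inF v)) ≡ restrict inF (deg E) v
  ω+2≡deg-on-F v with F at v in Fv
  ... | false = refl
  ... | true with R at v in Rv
  ...   | true  = ⊥-elim (disjoint v (Fv , Rv))
  ...   | false = ℕP.m∸n+n≡m (deg≥2 v)

  ω+2≤deg-off-F : ∀ v → ω E R v + (𝟙 (outF v) + 𝟙 (outF v)) ≤ restrict inF (ω E R) v + restrict outF (deg E) v
  ω+2≤deg-off-F v with F at v
  ... | true  = ℕP.≤-refl
  ... | false = ℕP.≤-trans (ℕP.+-monoˡ-≤ 2 (ω≤deg∸2 v)) (ℕP.≤-reflexive (ℕP.m∸n+n≡m (deg≥2 v)))

  ωV≡∑ω : ωSet E R V ≡ ∑ (ω E R)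
  ωV≡∑ω = trans (sumOver≡∑ (ω E R) V)
                (sum-cong-≗ λ v → cong (if_then ω E R v else 0) (VecP.lookup-replicate v true))

  ωF+2k≡degF : ωSet E R F + (k + k) ≡ degSet E F
  ωF+2k≡degF = begin
    ωSet E R F + (k + k)
      ≡⟨ cong₂ _+_ (sumOver≡∑ (ω E R) F) (cong₂ _+_ (∣∣≡size F) (∣∣≡size F)) ⟩
    ∑ (restrict inF (ω E R)) + (size inF + size inF)
      ≡⟨ cong (_+_ (∑ (restrict inF (ω E R)))) (∑-distrib-+ (𝟙 ∘ inF) (𝟙 ∘ inF)) ⟨
    ∑ (restrict inF (ω E R)) + ∑ (λ v → 𝟙 (inF v) + 𝟙 (inF v))
      ≡⟨ ∑-distrib-+ (restrict inF (ω E R)) _ ⟨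
    ∑ (λ v → restrict inF (ω E R) v + (𝟙 (inF v) + 𝟙 (inF v)))
      ≡⟨ sum-cong-≗ ω+2≡deg-on-F ⟩
    ∑ (restrict inF (deg E))
      ≡⟨ sumOver≡∑ (deg E) F ⟨
    degSet E F ∎
    where open ≡-Reasoning

  H≤c+ℓ : H ≤ c + ℓ
  H≤c+ℓ with forest
  ... | E′ , E′⊆ , H≤E′+ℓ , E′-forest =
    ℕP.≤-trans H≤E′+ℓ
      (ℕP.+-monoˡ-≤ ℓ (forest-edges≤ E′ outF (All-resp-⊆ E′⊆ (deleteVertices-avoids F E)) E′-forest))

  deg-outF≤ : ∑ (restrict outF (deg E)) ≤ ((c + ℓ) + (c + ℓ)) + degSet E F
  deg-outF≤ = begin
    ∑ (restrict outF (deg E))           ≡⟨ handshake outF E ⟩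
    sum (map (endsIn outF) E)           ≤⟨ ends-outside-independent F E independent ⟩
    (H + H) + sum (map (endsIn inF) E)  ≡⟨ cong (_+_ (H + H)) (handshake inF E) ⟨
    (H + H) + ∑ (restrict inF (deg E))  ≡⟨ cong (_+_ (H + H)) (sumOver≡∑ (deg E) F) ⟨
    (H + H) + degSet E F                ≤⟨ ℕP.+-monoˡ-≤ (degSet E F) (ℕP.+-mono-≤ H≤c+ℓ H≤c+ℓ) ⟩
    ((c + ℓ) + (c + ℓ)) + degSet E F    ∎
    where open ℕP.≤-Reasoning

  ωV+2c≤ωF+deg-outF : ωSet E R V + (c + c) ≤ ωSet E R F + ∑ (restrict outF (deg E))
  ωV+2c≤ωF+deg-outF = begin
    ωSet E R V + (c + c)
      ≡⟨ cong₂ _+_ (sym ωV≡∑ω) (∑-distrib-+ (𝟙 ∘ outF) (𝟙 ∘ outF)) ⟨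
    ∑ (ω E R) + ∑ (λ v → 𝟙 (outF v) + 𝟙 (outF v))
      ≡⟨ ∑-distrib-+ (ω E R) _ ⟨
    ∑ (λ v → ω E R v + (𝟙 (outF v) + 𝟙 (outF v)))
      ≤⟨ ∑-mono-≤ ω+2≤deg-off-F ⟩
    ∑ (λ v → restrict inF (ω E R) v + restrict outF (deg E) v)
      ≡⟨ ∑-distrib-+ (restrict inF (ω E R)) (restrict outF (deg E)) ⟩
    ∑ (restrict inF (ω E R)) + ∑ (restrict outF (deg E))
      ≡⟨ cong (_+ ∑ (restrict outF (deg E))) (sumOver≡∑ (ω E R) F) ⟨
    ωSet E R F + ∑ (restrict outF (deg E)) ∎
    where open ℕP.≤-Reasoning

  ωV≤2ωF+2[k+ℓ] : ωSet E R V ≤ (ωSet E R F + ωSet E R F) + ((k + ℓ) + (k + ℓ))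
  ωV≤2ωF+2[k+ℓ] = ℕP.+-cancelʳ-≤ (c + c) _ _ (begin
    ωSet E R V + (c + c)                                   ≤⟨ ωV+2c≤ωF+deg-outF ⟩
    ωSet E R F + ∑ (restrict outF (deg E))                 ≤⟨ ℕP.+-monoʳ-≤ (ωSet E R F) deg-outF≤ ⟩
    ωSet E R F + (((c + ℓ) + (c + ℓ)) + degSet E F)
      ≡⟨ cong (λ d → ωSet E R F + (((c + ℓ) + (c + ℓ)) + d)) ωF+2k≡degF ⟨
    ωSet E R F + (((c + ℓ) + (c + ℓ)) + (ωSet E R F + (k + k)))
                                                            ≡⟨ regroup (ωSet E R F) k ℓ c ⟩
    ((ωSet E R F + ωSet E R F) + ((k + ℓ) + (k + ℓ))) + (c + c) ∎)
    where
    open ℕP.≤-Reasoning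
    regroup : ∀ a k ℓ c → a + (((c + ℓ) + (c + ℓ)) + (a + (k + k))) ≡ ((a + a) + ((k + ℓ) + (k + ℓ))) + (c + c)
    regroup = solve-∀

  ωF≤ωV : ωSet E R F ≤ ωSet E R V
  ωF≤ωV = subst₂ _≤_ (sym (sumOver≡∑ (ω E R) F)) (sym ωV≡∑ω) (∑-mono-≤ (restrict≤ inF (ω E R)))

  total-deg≤ : ∑ (deg E) ≤ (degSet E F + degSet E F) + ((c + ℓ) + (c + ℓ))
  total-deg≤ = begin
    ∑ (deg E)
      ≡⟨ trans (sum-cong-≗ (restrict-split inF (deg E))) (∑-distrib-+ (restrict inF (deg E)) _) ⟩
    ∑ (restrict inF (deg E)) + ∑ (restrict outF (deg E))
      ≤⟨ ℕP.+-mono-≤ (ℕP.≤-reflexive (sym (sumOver≡∑ (deg E) F))) deg-outF≤ ⟩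
    degSet E F + (((c + ℓ) + (c + ℓ)) + degSet E F)
      ≡⟨ regroup (degSet E F) (c + ℓ) ⟩
    (degSet E F + degSet E F) + ((c + ℓ) + (c + ℓ)) ∎
    where
    open ℕP.≤-Reasoning
    regroup : ∀ d s → d + ((s + s) + d) ≡ (d + d) + (s + s)
    regroup = solve-∀

  k+ℓ≢0 : ∃ (λ v → 3 ≤ deg E v) → k + ℓ ≢ 0
  k+ℓ≢0 (w , 3≤deg) k+ℓ≡0 = ℕP.<-irrefl refl (ℕP.<-≤-trans (∑-mono-< deg≥2 w 3≤deg) ∑deg≤2n)
    where
    vanish : ∀ v → 𝟙 (inF v) ≡ 0 → restrict inF (deg E) v ≡ 0
    vanish v with inF v
    ... | false = λ _ → refl
    ... | true  = λ ()
    degF≡0 : degSet E F ≡ 0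
    degF≡0 = trans (sumOver≡∑ (deg E) F)
                   (∑≡0-transfer vanish (trans (sym (∣∣≡size F)) (ℕP.m+n≡0⇒m≡0 k k+ℓ≡0)))
    𝟙+𝟙≤2 : ∀ b → 𝟙 b + 𝟙 b ≤ 2
    𝟙+𝟙≤2 true  = ℕP.≤-refl
    𝟙+𝟙≤2 false = z≤n
    ∑deg≤2n : ∑ (deg E) ≤ ∑ (λ (_ : Fin n) → 2)
    ∑deg≤2n = begin
      ∑ (deg E)                                        ≤⟨ total-deg≤ ⟩
      (degSet E F + degSet E F) + ((c + ℓ) + (c + ℓ))  ≡⟨ cong₂ (λ d l → (d + d) + ((c + l) + (c + l)))
                                                                degF≡0 (ℕP.m+n≡0⇒n≡0 k k+ℓ≡0) ⟩
      (c + 0) + (c + 0)                                ≡⟨ cong (λ x → x + x) (ℕP.+-identityʳ c) ⟩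
      c + c                                            ≡⟨ ∑-distrib-+ (𝟙 ∘ outF) (𝟙 ∘ outF) ⟨
      ∑ (λ v → 𝟙 (outF v) + 𝟙 (outF v))                ≤⟨ ∑-mono-≤ (𝟙+𝟙≤2 ∘ outF) ⟩
      ∑ (λ (_ : Fin n) → 2)                            ∎
      where open ℕP.≤-Reasoning

ι : ℕ → ℚ
ι m = + m ℚ./ 1

ι≡mkℚ : ∀ m → ι m ≡ mkℚ (+ m) 0 (Coprime.sym (Coprime.1-coprimeTo m))
ι≡mkℚ m = ℚP.normalize-coprime (Coprime.sym (Coprime.1-coprimeTo m))

ι-+ : ∀ m m′ → ι (m + m′) ≡ ι m ℚ.+ ι m′
ι-+ m m′ = ℚP.toℚᵘ-injective (begin
  ℚ.toℚᵘ (ι (m + m′))                   ≈⟨ ℚᵘP.≃-reflexive (cong ℚ.toℚᵘ (ι≡mkℚ (m + m′))) ⟩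
  ℚᵘ.mkℚᵘ (+ (m + m′)) 0                 ≈⟨ ℚᵘ.*≡* cross ⟩
  ℚᵘ.mkℚᵘ (+ m) 0 ℚᵘ.+ ℚᵘ.mkℚᵘ (+ m′) 0  ≈⟨ ℚᵘP.+-cong (ℚᵘP.≃-reflexive (cong ℚ.toℚᵘ (ι≡mkℚ m)))
                                                       (ℚᵘP.≃-reflexive (cong ℚ.toℚᵘ (ι≡mkℚ m′))) ⟨
  ℚ.toℚᵘ (ι m) ℚᵘ.+ ℚ.toℚᵘ (ι m′)        ≈⟨ ℚP.toℚᵘ-homo-+ (ι m) (ι m′) ⟨
  ℚ.toℚᵘ (ι m ℚ.+ ι m′)                 ∎)
  where
  open ℚᵘP.≃-Reasoning
  cross : + (m + m′) ℤ.* + 1 ≡ (+ m ℤ.* + 1 ℤ.+ + m′ ℤ.* + 1) ℤ.* + 1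
  cross rewrite ℤP.*-identityʳ (+ m) | ℤP.*-identityʳ (+ m′) | ℤP.*-identityʳ (+ m ℤ.+ + m′) = ℤP.pos-+ m m′

ι-mono-≤ : ∀ {m m′} → m ≤ m′ → ι m ℚ.≤ ι m′
ι-mono-≤ {m} {m′} m≤m′ rewrite ι≡mkℚ m | ι≡mkℚ m′ =
  ℚ.*≤* (subst₂ ℤ._≤_ (sym (ℤP.*-identityʳ (+ m))) (sym (ℤP.*-identityʳ (+ m′))) (ℤ.+≤+ m≤m′))

ι-cancel-≤ : ∀ {m m′} → ι m ℚ.≤ ι m′ → m ≤ m′
ι-cancel-≤ {m} {m′} ιm≤ιm′ rewrite ι≡mkℚ m | ι≡mkℚ m′ with ιm≤ιm′
... | ℚ.*≤* cross = ℤP.drop‿+≤+ (subst₂ ℤ._≤_ (ℤP.*-identityʳ (+ m)) (ℤP.*-identityʳ (+ m′)) cross)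

/-*-ι : ∀ a b → (+ a ℚ./ suc b) ℚ.* ι (suc b) ≡ ι a
/-*-ι a b = ℚP.toℚᵘ-injective (begin
  ℚ.toℚᵘ ((+ a ℚ./ suc b) ℚ.* ι (suc b))       ≈⟨ ℚP.toℚᵘ-homo-* (+ a ℚ./ suc b) (ι (suc b)) ⟩
  ℚ.toℚᵘ (+ a ℚ./ suc b) ℚᵘ.* ℚ.toℚᵘ (ι (suc b)) ≈⟨ ℚᵘP.*-cong (ℚP.toℚᵘ-fromℚᵘ (ℚᵘ.mkℚᵘ (+ a) b))
                                                                (ℚᵘP.≃-reflexive (cong ℚ.toℚᵘ (ι≡mkℚ (suc b)))) ⟩
  ℚᵘ.mkℚᵘ (+ a) b ℚᵘ.* ℚᵘ.mkℚᵘ (+ suc b) 0       ≈⟨ ℚᵘ.*≡* cross ⟩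
  ℚᵘ.mkℚᵘ (+ a) 0                               ≈⟨ ℚᵘP.≃-reflexive (cong ℚ.toℚᵘ (ι≡mkℚ a)) ⟨
  ℚ.toℚᵘ (ι a)                                  ∎)
  where
  open ℚᵘP.≃-Reasoning
  cross : (+ a ℤ.* + suc b) ℤ.* + 1 ≡ + a ℤ.* + (suc b ℕ.* 1)
  cross rewrite ℤP.*-identityʳ (+ a ℤ.* + suc b) | ℕP.*-identityʳ (suc b) = refl

0<q-p : ∀ {p q} → p ℚ.< q → 0ℚ ℚ.< q ℚ.- p
0<q-p {p} {q} p<q = subst (ℚ._< q ℚ.- p) (ℚP.+-inverseʳ p) (ℚP.+-monoˡ-< (ℚ.- p) p<q)

0≤q-p : ∀ {p q} → p ℚ.≤ q → 0ℚ ℚ.≤ q ℚ.- p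
0≤q-p {p} {q} p≤q = subst (ℚ._≤ q ℚ.- p) (ℚP.+-inverseʳ p) (ℚP.+-monoˡ-≤ (ℚ.- p) p≤q)

≤-by-gap : ∀ {p q} r → 0ℚ ℚ.≤ r → q ≡ p ℚ.+ r → p ℚ.≤ q
≤-by-gap {p} r 0≤r refl = subst (ℚ._≤ p ℚ.+ r) (ℚP.+-identityʳ p) (ℚP.+-monoʳ-≤ p 0≤r)

threshold-margin : ∀ ε (ε<1 : ε ℚ.< 1ℚ) k ℓ a →
                   threshold ε ε<1 ℚ.* ι (k + ℓ) ℚ.≤ ι (a + (k + k)) →
                   ι (k + ℓ) ℚ.+ ι (k + ℓ) ℚ.≤ (1ℚ ℚ.- ε) ℚ.* ι a
threshold-margin ε ε<1 k ℓ a threshold≤ =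
  ≤-by-gap (gap ℚ.+ (u ℚ.* ι ℓ ℚ.+ u ℚ.* ι ℓ)) (ℚP.+-mono-≤ (0≤q-p cleared) (ℚP.+-mono-≤ 0≤uℓ 0≤uℓ)) regroup
  where
  u = 1ℚ ℚ.- ε
  instance
    u-positive : ℚ.Positive u
    u-positive = ℚ.positive (0<q-p ε<1)
    u-nonZero : ℚ.NonZero u
    u-nonZero = ℚP.pos⇒nonZero u
    u-nonNeg : ℚ.NonNegative u
    u-nonNeg = ℚP.pos⇒nonNeg u
  T = ι 4 ℚ.- ι 2 ℚ.* ε
  S = ι (k + ℓ)
  D = ι (a + (k + k))
  cleared : T ℚ.* S ℚ.≤ D ℚ.* u
  cleared = subst (ℚ._≤ D ℚ.* u) (begin
    ((T ℚ.* ℚ.1/ u) ℚ.* S) ℚ.* u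
      ≡⟨ solve 4 (λ t i s u → ((t :* i) :* s) :* u := (t :* s) :* (i :* u)) refl T (ℚ.1/ u) S u ⟩
    (T ℚ.* S) ℚ.* (ℚ.1/ u ℚ.* u)   ≡⟨ cong (ℚ._*_ (T ℚ.* S)) (ℚP.*-inverseˡ u) ⟩
    (T ℚ.* S) ℚ.* 1ℚ               ≡⟨ ℚP.*-identityʳ (T ℚ.* S) ⟩
    T ℚ.* S                        ∎)
    (ℚP.*-monoʳ-≤-nonNeg u threshold≤)
    where open ≡-Reasoning
  gap = D ℚ.* u ℚ.- T ℚ.* S
  0≤uℓ : 0ℚ ℚ.≤ u ℚ.* ι ℓ
  0≤uℓ = subst (ℚ._≤ u ℚ.* ι ℓ) (ℚP.*-zeroʳ u) (ℚP.*-monoˡ-≤-nonNeg u (ι-mono-≤ (z≤n {ℓ})))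
  regroup : u ℚ.* ι a ≡ (S ℚ.+ S) ℚ.+ (gap ℚ.+ (u ℚ.* ι ℓ ℚ.+ u ℚ.* ι ℓ))
  regroup rewrite ι-+ k ℓ | ι-+ a (k + k) | ι-+ k k =
    solve 4 (λ e a k l →
      (con 1ℚ :- e) :* a
        := ((k :+ l) :+ (k :+ l))
           :+ ((((a :+ (k :+ k)) :* (con 1ℚ :- e)) :- ((con (ι 4) :- con (ι 2) :* e) :* (k :+ l)))
               :+ ((con 1ℚ :- e) :* l :+ (con 1ℚ :- e) :* l)))
      refl ε (ι a) (ι k) (ι ℓ)

margin⇒positive : ∀ ε s a → 0 < s → ι s ℚ.+ ι s ℚ.≤ (1ℚ ℚ.- ε) ℚ.* ι a → 0 < a
margin⇒positive ε s zero    0<s margin = ⊥-elim (ℕP.<⇒≱ (ℕP.<-≤-trans 0<s (ℕP.m≤m+n s s))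
  (ι-cancel-≤ (subst₂ ℚ._≤_ (sym (ι-+ s s)) (ℚP.*-zeroʳ (1ℚ ℚ.- ε)) margin)))
margin⇒positive ε s (suc a) 0<s margin = s≤s z≤n

lowerProb≤ratio : ∀ ε (ε<1 : ε ℚ.< 1ℚ) s a b .{{_ : ℕ.NonZero b}} → ι s ℚ.+ ι s ℚ.≤ (1ℚ ℚ.- ε) ℚ.* ι a →
                  b ≤ (a + a) + (s + s) → lowerProb ε ε<1 ℚ.≤ + a ℚ./ b
lowerProb≤ratio ε ε<1 s a (suc b) margin b≤ =
  ℚP.*-cancelʳ-≤-pos (v ℚ.* B) (subst₂ ℚ._≤_ (sym 1/v*vB≡B) (sym ratio*vB≡vA) B≤vA)
  where
  v = 3ℚ ℚ.- ε
  A = ι a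
  B = ι (suc b)
  instance
    v-positive : ℚ.Positive v
    v-positive = ℚ.positive (0<q-p (ℚP.<-trans ε<1 1<3))
    v-nonZero : ℚ.NonZero v
    v-nonZero = ℚP.pos⇒nonZero v
    B-positive : ℚ.Positive B
    B-positive = ℚ.positive (ℚP.<-≤-trans (ℚP.positive⁻¹ 1ℚ) (ι-mono-≤ (s≤s (z≤n {b}))))
    vB-positive : ℚ.Positive (v ℚ.* B)
    vB-positive = ℚP.pos*pos⇒pos v B
  B≤vA : B ℚ.≤ v ℚ.* A
  B≤vA = begin
    B                                             ≤⟨ ι-mono-≤ b≤ ⟩
    ι ((a + a) + (s + s))                         ≡⟨ trans (ι-+ (a + a) (s + s)) (cong₂ ℚ._+_ (ι-+ a a) (ι-+ s s)) ⟩
    (A ℚ.+ A) ℚ.+ (ι s ℚ.+ ι s)                   ≤⟨ ℚP.+-monoʳ-≤ (A ℚ.+ A) margin ⟩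
    (A ℚ.+ A) ℚ.+ (1ℚ ℚ.- ε) ℚ.* A
      ≡⟨ solve 2 (λ e a → (a :+ a) :+ (con 1ℚ :- e) :* a := (con 3ℚ :- e) :* a) refl ε A ⟩
    v ℚ.* A                                       ∎
    where open ℚP.≤-Reasoning
  1/v*vB≡B : ℚ.1/ v ℚ.* (v ℚ.* B) ≡ B
  1/v*vB≡B = begin
    ℚ.1/ v ℚ.* (v ℚ.* B)  ≡⟨ ℚP.*-assoc (ℚ.1/ v) v B ⟨
    (ℚ.1/ v ℚ.* v) ℚ.* B  ≡⟨ cong (ℚ._* B) (ℚP.*-inverseˡ v) ⟩
    1ℚ ℚ.* B              ≡⟨ ℚP.*-identityˡ B ⟩
    B                     ∎
    where open ≡-Reasoning
  ratio*vB≡vA : (+ a ℚ./ suc b) ℚ.* (v ℚ.* B) ≡ v ℚ.* A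
  ratio*vB≡vA = begin
    (+ a ℚ./ suc b) ℚ.* (v ℚ.* B)  ≡⟨ ℚP.*-comm _ (v ℚ.* B) ⟩
    (v ℚ.* B) ℚ.* (+ a ℚ./ suc b)  ≡⟨ ℚP.*-assoc v B _ ⟩
    v ℚ.* (B ℚ.* (+ a ℚ./ suc b))  ≡⟨ cong (ℚ._*_ v) (ℚP.*-comm B _) ⟩
    v ℚ.* ((+ a ℚ./ suc b) ℚ.* B)  ≡⟨ cong (ℚ._*_ v) (/-*-ι a b) ⟩
    v ℚ.* A                        ∎
    where open ≡-Reasoning

lemma20 : (n : ℕ) (E : EdgeList n)
          → (∀ v → 2 ≤ deg E v)
          → ∃ (λ v → 3 ≤ deg E v)
          → (R : Subset n) (ℓ : ℕ) (ε : ℚ) → 0ℚ ℚ.< ε → (ε<1 : ε ℚ.< 1ℚ)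
          → (F : Subset n) → Riafd E R ℓ F
          → threshold ε ε<1 ℚ.* ((+ (∣ F ∣ Data.Nat.+ ℓ)) ℚ./ 1) ℚ.≤ ((+ degSet E F) ℚ./ 1)
          → Σ (0 < ωSet E R V) (λ pos → lowerProb ε ε<1 ℚ.≤ sampleProb E R F pos)
lemma20 n E deg≥2 deg≥3 R ℓ ε _ ε<1 F riafd threshold≤ = 0<ωV , lowerProb≤ωF/ωV
  where
  open Counting E deg≥2 R ℓ F riafd
  margin : ι (k + ℓ) ℚ.+ ι (k + ℓ) ℚ.≤ (1ℚ ℚ.- ε) ℚ.* ι (ωSet E R F)
  margin = threshold-margin ε ε<1 k ℓ (ωSet E R F)
    (subst (λ d → threshold ε ε<1 ℚ.* ι (k + ℓ) ℚ.≤ ι d) (sym ωF+2k≡degF) threshold≤)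
  0<ωV : 0 < ωSet E R V
  0<ωV = ℕP.<-≤-trans (margin⇒positive ε (k + ℓ) (ωSet E R F) (ℕP.n≢0⇒n>0 (k+ℓ≢0 deg≥3)) margin) ωF≤ωV
  lowerProb≤ωF/ωV : lowerProb ε ε<1 ℚ.≤ sampleProb E R F 0<ωV
  lowerProb≤ωF/ωV =
    lowerProb≤ratio ε ε<1 (k + ℓ) (ωSet E R F) (ωSet E R V) {{ℕ.>-nonZero 0<ωV}} margin ωV≤2ωF+2[k+ℓ]
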